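{- Let $\mathcal{E}$ be the set of Łukasiewicz paths in which every up step $U_k$ ($k\geq1$) is immediately followed by a flat step $F$, and every flat step at positive height is immediately preceded by an up step $U_k$ for some $k\geq 1$. For every $n\geq 0$, there is a bijection between the set of paths of length $n$ in $\mathcal{E}$ and the set of $U_kF$-equivalence classes of the set $\mathcal{L}_n$ of Łukasiewicz paths of length $n$.
   Context: A Łukasiewicz path of length $n$ is a sequence of $n$ steps from $\{(1,i): i\geq -1\}$ starting at $(0,0)$, ending at $(n,0)$ and never going below the $x$-axis. Write $D=(1,-1)$, $F=(1,0)$, $U_k=(1,k)$ for $k\geq1$. The height of a step is the minimal ordinate of its endpoints. Steps are numbered $1,\dots,n$; an occurrence of $U_kF$ is at position $i$ if its $U_k$ is the $i$-th step. Two Łukasiewicz paths of the same length are $U_kF$-equivalent if for every $k\geq1$ the set of occurrence positions of $U_kF$ is the same in both. -}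

module Defs where

open import Data.Nat using (ℕ; zero; suc; _∸_)
open import Data.Integer as ℤ using (ℤ; +_; -[1+_]; _≤_; _<_)
open import Data.List using (List; []; _∷_; length; take; map; foldr)
open import Data.Maybe using (Maybe; just; nothing)
open import Data.Product using (Σ; ∃; _×_; _,_; proj₁)
open import Relation.Binary.PropositionalEquality using (_≡_; refl; sym; trans; isEquivalence)
open import Relation.Binary.Bundles using (Setoid)
open import Relation.Binary.Structures using (IsEquivalence)
open import Function.Bundles using (_⇔_; mk⇔; Equivalence)
open import Level using (0ℓ)

-- A step (1,i), i ≥ -1.
--   D      = (1,-1)
--   F      = (1,0)
--   U k    = U_{k+1} = (1,k+1)   (so U_k for k ≥ 1 is  U (k - 1))
data Step : Set where
  D : Step
  F : Step
  U : ℕ → Step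

inc : Step → ℤ
inc D     = -[1+ 0 ]
inc F     = + 0
inc (U k) = + suc k

alt : List Step → ℕ → ℤ
alt p j = foldr ℤ._+_ (+ 0) (map inc (take j p))

IsLuk : List Step → Set
IsLuk p = (∀ j → + 0 ≤ alt p j) × (alt p (length p) ≡ + 0)

-- the i-th step (steps numbered 1..n); nothing if out of range
stepAt : List Step → ℕ → Maybe Step
stepAt []      _             = nothing
stepAt (s ∷ p) zero          = nothing
stepAt (s ∷ p) (suc zero)    = just s
stepAt (s ∷ p) (suc (suc i)) = stepAt p (suc i)

height : List Step → ℕ → ℤ
height p i = alt p (i ∸ 1) ℤ.⊓ alt p i

-- U_{k+1}F occurs at position i
Occ : List Step → ℕ → ℕ → Set
Occ p k i = (stepAt p i ≡ just (U k)) × (stepAt p (suc i) ≡ just F)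

_≈UF_ : List Step → List Step → Set
p ≈UF q = ∀ k i → Occ p k i ⇔ Occ q k i

InE : List Step → Set
InE p = (∀ i k → stepAt p i ≡ just (U k) → stepAt p (suc i) ≡ just F)
      × (∀ i → stepAt p i ≡ just F → + 0 < height p i
             → ∃ λ k → stepAt p (i ∸ 1) ≡ just (U k))

Luk : ℕ → Set
Luk n = Σ (List Step) λ p → (length p ≡ n) × IsLuk p

LukE : ℕ → Set
LukE n = Σ (List Step) λ p → (length p ≡ n) × IsLuk p × InE p

E-setoid : ℕ → Setoid 0ℓ 0ℓ
E-setoid n = record
  { Carrier = LukE n
  ; _≈_ = λ a b → proj₁ a ≡ proj₁ b
  ; isEquivalence = record { refl = refl ; sym = sym ; trans = trans } }

-- 𝓛_n as a setoid under U_kF-equivalence: its quotient is the set of classes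
L/≈-setoid : ℕ → Setoid 0ℓ 0ℓ
L/≈-setoid n = record
  { Carrier = Luk n
  ; _≈_ = λ a b → proj₁ a ≈UF proj₁ b
  ; isEquivalence = record
      { refl = λ k i → mk⇔ (λ x → x) (λ x → x)
      ; sym = λ e k i → mk⇔ (Equivalence.from (e k i)) (Equivalence.to (e k i))
      ; trans = λ e f k i → mk⇔ (λ x → Equivalence.to (f k i) (Equivalence.to (e k i) x))
                                (λ x → Equivalence.from (e k i) (Equivalence.from (f k i) x)) } }

module Submission where

-- The paths of 𝓔 are exactly those built from down steps, flat steps on the
-- axis and blocks U_kF.  Between two blocks such a path is forced to go down
-- while it is above the axis and to stay flat on it, so it is determined by its
-- length and the positions of its U_kF blocks.  Conversely, keeping the U_kF
-- occurrences of a Łukasiewicz path and replacing each of its other steps by D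
-- above the axis and by F on it gives a path of 𝓔 with the same occurrences:
-- its altitude never exceeds that of the original path, so it stays above the
-- axis and returns to it.

open import Defs
open import Data.Nat using (ℕ; zero; suc; pred; _+_; _∸_; _≤_; z≤n; s≤s)
open import Data.Nat.Properties using (suc-injective; ≤-trans; pred-mono-≤; pred[n]≤n; m≤m+n; +-monoˡ-≤)
open import Data.Integer as ℤ using (ℤ; +_; +≤+; +<+)
open import Data.Integer.Properties using (+-identityˡ; +-identityʳ; +-assoc)
open import Data.List using (List; []; _∷_; length)
open import Data.Maybe using (just)
open import Data.Maybe.Properties using (just-injective)
open import Data.Product as Product using (∃; _×_; _,_; proj₁)
open import Data.Empty using (⊥-elim)
open import Function using (_∘_)
open import Relation.Nullary using (¬_)
open import Relation.Binary.PropositionalEquality using (_≡_; _≢_; refl; sym; trans; cong; cong₂; subst)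
open import Function.Bundles using (Bijection; _⇔_; mk⇔; Equivalence)
open import Function.Construct.Identity using (⇔-id)

stepAt-zero : ∀ p {s} → stepAt p 0 ≢ just s
stepAt-zero []      ()
stepAt-zero (_ ∷ _) ()

-- F is treated separately so that the altitude after any step taken at + h
-- reduces to a literal + h′.

altAfter : ℤ → Step → ℤ
altAfter z F = z
altAfter z s = z ℤ.+ inc s

altFrom : ℤ → List Step → ℕ → ℤ
altFrom z p j = z ℤ.+ alt p j

altFrom-∷ : ∀ z s p j → altFrom z (s ∷ p) (suc j) ≡ altFrom (altAfter z s) p j
altFrom-∷ z D     p j = sym (+-assoc z (inc D) (alt p j))
altFrom-∷ z F     p j = cong (ℤ._+_ z) (+-identityˡ (alt p j))
altFrom-∷ z (U k) p j = sym (+-assoc z (inc (U k)) (alt p j))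

heightFrom : ℤ → List Step → ℕ → ℤ
heightFrom z p i = altFrom z p (i ∸ 1) ℤ.⊓ altFrom z p i

heightFrom-∷ : ∀ z s p i → heightFrom z (s ∷ p) (suc (suc i)) ≡ heightFrom (altAfter z s) p (suc i)
heightFrom-∷ z s p i = cong₂ ℤ._⊓_ (altFrom-∷ z s p i) (altFrom-∷ z s p (suc i))

heightFrom-∷₂ : ∀ z s t p i →
                heightFrom z (s ∷ t ∷ p) (suc (suc (suc i))) ≡ heightFrom (altAfter (altAfter z s) t) p (suc i)
heightFrom-∷₂ z s t p i = trans (heightFrom-∷ z s (t ∷ p) (suc i)) (heightFrom-∷ (altAfter z s) t p i)

heightFrom-zero : ∀ p i → heightFrom (+ 0) p i ≡ height p i
heightFrom-zero p i = cong₂ ℤ._⊓_ (+-identityˡ _) (+-identityˡ _)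

record IsLukFrom (z : ℤ) (p : List Step) : Set where
  field
    nonneg     : ∀ j → + 0 ℤ.≤ altFrom z p j
    endsOnAxis : altFrom z p (length p) ≡ + 0
open IsLukFrom

isLuk⇔isLukFrom₀ : ∀ p → IsLuk p ⇔ IsLukFrom (+ 0) p
isLuk⇔isLukFrom₀ p = mk⇔
  (λ (above , end) → record
    { nonneg = λ j → subst (+ 0 ℤ.≤_) (sym (+-identityˡ _)) (above j)
    ; endsOnAxis = trans (+-identityˡ _) end })
  (λ l → (λ j → subst (+ 0 ℤ.≤_) (+-identityˡ _) (l .nonneg j)) , trans (sym (+-identityˡ _)) (l .endsOnAxis))

isLukFrom-tail : ∀ {z s p} → IsLukFrom z (s ∷ p) → IsLukFrom (altAfter z s) p
isLukFrom-tail {z} {s} {p} l .nonneg j = subst (+ 0 ℤ.≤_) (altFrom-∷ z s p j) (l .nonneg (suc j))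
isLukFrom-tail {z} {s} {p} l .endsOnAxis = trans (sym (altFrom-∷ z s p (length p))) (l .endsOnAxis)

isLukFrom-∷ : ∀ {z s p} → + 0 ℤ.≤ z → IsLukFrom (altAfter z s) p → IsLukFrom z (s ∷ p)
isLukFrom-∷ {z}         0≤z l .nonneg zero    = subst (+ 0 ℤ.≤_) (sym (+-identityʳ z)) 0≤z
isLukFrom-∷ {z} {s} {p} 0≤z l .nonneg (suc j) = subst (+ 0 ℤ.≤_) (sym (altFrom-∷ z s p j)) (l .nonneg j)
isLukFrom-∷ {z} {s} {p} 0≤z l .endsOnAxis     = trans (altFrom-∷ z s p (length p)) (l .endsOnAxis)

data LukPath : ℕ → List Step → Set where
  done : LukPath 0 []
  down : ∀ {h p} → LukPath h p → LukPath (suc h) (D ∷ p)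
  flat : ∀ {h p} → LukPath h p → LukPath h (F ∷ p)
  up   : ∀ {h k p} → LukPath (h + suc k) p → LukPath h (U k ∷ p)

isLukFrom⇒LukPath : ∀ {h} p → IsLukFrom (+ h) p → LukPath h p
isLukFrom⇒LukPath {zero}  []        _ = done
isLukFrom⇒LukPath {suc h} []        l with l .endsOnAxis
... | ()
isLukFrom⇒LukPath {zero}  (D ∷ p)   l with l .nonneg 1
... | ()
isLukFrom⇒LukPath {suc h} (D ∷ p)   l = down (isLukFrom⇒LukPath p (isLukFrom-tail l))
isLukFrom⇒LukPath         (F ∷ p)   l = flat (isLukFrom⇒LukPath p (isLukFrom-tail l))
isLukFrom⇒LukPath         (U k ∷ p) l = up (isLukFrom⇒LukPath p (isLukFrom-tail l))

LukPath⇒isLukFrom : ∀ {h p} → LukPath h p → IsLukFrom (+ h) p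
LukPath⇒isLukFrom done .nonneg zero    = +≤+ z≤n
LukPath⇒isLukFrom done .nonneg (suc _) = +≤+ z≤n
LukPath⇒isLukFrom done .endsOnAxis     = refl
LukPath⇒isLukFrom (down l) = isLukFrom-∷ (+≤+ z≤n) (LukPath⇒isLukFrom l)
LukPath⇒isLukFrom (flat l) = isLukFrom-∷ (+≤+ z≤n) (LukPath⇒isLukFrom l)
LukPath⇒isLukFrom (up l)   = isLukFrom-∷ (+≤+ z≤n) (LukPath⇒isLukFrom l)

record UpsFollowedByFlat (p : List Step) : Set where
  field
    followedByFlat : ∀ i k → stepAt p i ≡ just (U k) → stepAt p (suc i) ≡ just F
open UpsFollowedByFlat

record FlatsPrecededByUp (z : ℤ) (p : List Step) : Set where
  field
    precededByUp : ∀ i → stepAt p i ≡ just F → + 0 ℤ.< heightFrom z p i → ∃ λ k → stepAt p (i ∸ 1) ≡ just (U k)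
open FlatsPrecededByUp

InEFrom : ℤ → List Step → Set
InEFrom z p = UpsFollowedByFlat p × FlatsPrecededByUp z p

InE⇔InEFrom₀ : ∀ p → InE p ⇔ InEFrom (+ 0) p
InE⇔InEFrom₀ p = mk⇔
  (λ (ups , flats) → record { followedByFlat = ups } , record
    { precededByUp = λ i e pos → flats i e (subst (+ 0 ℤ.<_) (heightFrom-zero p i) pos) })
  (λ (ups , flats) → ups .followedByFlat ,
    λ i e pos → flats .precededByUp i e (subst (+ 0 ℤ.<_) (sym (heightFrom-zero p i)) pos))

upsFollowedByFlat-tail : ∀ {s p} → UpsFollowedByFlat (s ∷ p) → UpsFollowedByFlat p
upsFollowedByFlat-tail {p = p} ups .followedByFlat zero    k e = ⊥-elim (stepAt-zero p e)
upsFollowedByFlat-tail         ups .followedByFlat (suc i) k e = ups .followedByFlat (suc (suc i)) k e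

upsFollowedByFlat-∷ : ∀ {s p} → (∀ k → s ≡ U k → stepAt p 1 ≡ just F) →
                      UpsFollowedByFlat p → UpsFollowedByFlat (s ∷ p)
upsFollowedByFlat-∷ first ups .followedByFlat zero          k ()
upsFollowedByFlat-∷ first ups .followedByFlat (suc zero)    k refl = first k refl
upsFollowedByFlat-∷ first ups .followedByFlat (suc (suc i)) k e    = ups .followedByFlat (suc i) k e

flatsPrecededByUp-tail : ∀ {z s p} → (∀ k → s ≢ U k) →
                         FlatsPrecededByUp z (s ∷ p) → FlatsPrecededByUp (altAfter z s) p
flatsPrecededByUp-tail {p = p} notUp flats .precededByUp zero e _ = ⊥-elim (stepAt-zero p e)
flatsPrecededByUp-tail {z} {s} {p} notUp flats .precededByUp (suc i) e pos
  with flats .precededByUp (suc (suc i)) e (subst (+ 0 ℤ.<_) (sym (heightFrom-∷ z s p i)) pos)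
flatsPrecededByUp-tail notUp flats .precededByUp (suc zero)    e pos | k , e′ =
  ⊥-elim (notUp k (just-injective e′))
flatsPrecededByUp-tail notUp flats .precededByUp (suc (suc i)) e pos | k , e′ = k , e′

flatsPrecededByUp-tail₂ : ∀ {z s t p} → (∀ k → t ≢ U k) →
                          FlatsPrecededByUp z (s ∷ t ∷ p) → FlatsPrecededByUp (altAfter (altAfter z s) t) p
flatsPrecededByUp-tail₂ {p = p} notUp flats .precededByUp zero e _ = ⊥-elim (stepAt-zero p e)
flatsPrecededByUp-tail₂ {z} {s} {t} {p} notUp flats .precededByUp (suc i) e pos
  with flats .precededByUp (suc (suc (suc i))) e
              (subst (+ 0 ℤ.<_) (sym (heightFrom-∷₂ z s t p i)) pos)
flatsPrecededByUp-tail₂ notUp flats .precededByUp (suc zero)    e pos | k , e′ =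
  ⊥-elim (notUp k (just-injective e′))
flatsPrecededByUp-tail₂ notUp flats .precededByUp (suc (suc i)) e pos | k , e′ = k , e′

-- No condition on s is needed at position 2: a flat first step of the tail at
-- positive height would already violate the tail hypothesis.
flatsPrecededByUp-∷ : ∀ {z s p} → (s ≡ F → ¬ (+ 0 ℤ.< heightFrom z (s ∷ p) 1)) →
                      FlatsPrecededByUp (altAfter z s) p → FlatsPrecededByUp z (s ∷ p)
flatsPrecededByUp-∷ lowFirst flats .precededByUp zero       ()
flatsPrecededByUp-∷ lowFirst flats .precededByUp (suc zero) refl pos = ⊥-elim (lowFirst refl pos)
flatsPrecededByUp-∷ {z} {s} {p} lowFirst flats .precededByUp (suc (suc i)) e pos
  with flats .precededByUp (suc i) e (subst (+ 0 ℤ.<_) (heightFrom-∷ z s p i) pos)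
flatsPrecededByUp-∷ {p = p} lowFirst flats .precededByUp (suc (suc zero)) e pos | k , e′ =
  ⊥-elim (stepAt-zero p e′)
flatsPrecededByUp-∷         lowFirst flats .precededByUp (suc (suc (suc i))) e pos | k , e′ = k , e′

flatsPrecededByUp-upFlat : ∀ {z k p} → FlatsPrecededByUp (altAfter z (U k)) p →
                           FlatsPrecededByUp z (U k ∷ F ∷ p)
flatsPrecededByUp-upFlat flats .precededByUp zero             ()
flatsPrecededByUp-upFlat flats .precededByUp (suc zero)       ()
flatsPrecededByUp-upFlat {k = k} flats .precededByUp (suc (suc zero)) _ _ = k , refl
flatsPrecededByUp-upFlat {z} {k} {p} flats .precededByUp (suc (suc (suc i))) e pos
  with flats .precededByUp (suc i) e (subst (+ 0 ℤ.<_) (heightFrom-∷₂ z (U k) F p i) pos)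
flatsPrecededByUp-upFlat {p = p} flats .precededByUp (suc (suc (suc zero))) e pos | k′ , e′ =
  ⊥-elim (stepAt-zero p e′)
flatsPrecededByUp-upFlat         flats .precededByUp (suc (suc (suc (suc i)))) e pos | k′ , e′ = k′ , e′

data EPath : ℕ → List Step → Set where
  done   : EPath 0 []
  down   : ∀ {h p} → EPath h p → EPath (suc h) (D ∷ p)
  flat₀  : ∀ {p} → EPath 0 p → EPath 0 (F ∷ p)
  upFlat : ∀ {h k p} → EPath (h + suc k) p → EPath h (U k ∷ F ∷ p)

EPath⇒LukPath : ∀ {h p} → EPath h p → LukPath h p
EPath⇒LukPath done       = done
EPath⇒LukPath (down e)   = down (EPath⇒LukPath e)
EPath⇒LukPath (flat₀ e)  = flat (EPath⇒LukPath e)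
EPath⇒LukPath (upFlat e) = up (flat (EPath⇒LukPath e))

EPath⇒InEFrom : ∀ {h p} → EPath h p → InEFrom (+ h) p
EPath⇒InEFrom done       =
  record { followedByFlat = λ _ _ () } , record { precededByUp = λ _ () }
EPath⇒InEFrom (down e)   =
  Product.map (upsFollowedByFlat-∷ (λ _ ())) (flatsPrecededByUp-∷ (λ ())) (EPath⇒InEFrom e)
EPath⇒InEFrom (flat₀ e)  =
  Product.map (upsFollowedByFlat-∷ (λ _ ())) (flatsPrecededByUp-∷ (λ _ → λ { (+<+ ()) })) (EPath⇒InEFrom e)
EPath⇒InEFrom (upFlat e) =
  Product.map (upsFollowedByFlat-∷ (λ _ _ → refl) ∘ upsFollowedByFlat-∷ (λ _ ())) flatsPrecededByUp-upFlat
              (EPath⇒InEFrom e)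

LukPath⇒EPath : ∀ {h p} → LukPath h p → InEFrom (+ h) p → EPath h p
LukPath⇒EPath done _ = done
LukPath⇒EPath (down l) (ups , flats) =
  down (LukPath⇒EPath l (upsFollowedByFlat-tail ups , flatsPrecededByUp-tail (λ _ ()) flats))
LukPath⇒EPath {zero} (flat l) (ups , flats) =
  flat₀ (LukPath⇒EPath l (upsFollowedByFlat-tail ups , flatsPrecededByUp-tail (λ _ ()) flats))
LukPath⇒EPath {suc h} (flat l) (_ , flats) with flats .precededByUp 1 refl (+<+ (s≤s z≤n))
... | _ , ()
LukPath⇒EPath (up {p = F ∷ p} (flat l)) (ups , flats) =
  upFlat (LukPath⇒EPath l (upsFollowedByFlat-tail (upsFollowedByFlat-tail ups) ,
                           flatsPrecededByUp-tail₂ (λ _ ()) flats))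
LukPath⇒EPath (up {k = k} {p = []}      _) (ups , _) with ups .followedByFlat 1 k refl
... | ()
LukPath⇒EPath (up {k = k} {p = D ∷ _}   _) (ups , _) with ups .followedByFlat 1 k refl
... | ()
LukPath⇒EPath (up {k = k} {p = U _ ∷ _} _) (ups , _) with ups .followedByFlat 1 k refl
... | ()

isLuk×InE⇒EPath : ∀ {p} → IsLuk p → InE p → EPath 0 p
isLuk×InE⇒EPath {p} luk inE =
  LukPath⇒EPath (isLukFrom⇒LukPath p (Equivalence.to (isLuk⇔isLukFrom₀ p) luk))
                (Equivalence.to (InE⇔InEFrom₀ p) inE)

EPath⇒isLuk : ∀ {p} → EPath 0 p → IsLuk p
EPath⇒isLuk {p} e = Equivalence.from (isLuk⇔isLukFrom₀ p) (LukPath⇒isLukFrom (EPath⇒LukPath e))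

EPath⇒InE : ∀ {p} → EPath 0 p → InE p
EPath⇒InE {p} e = Equivalence.from (InE⇔InEFrom₀ p) (EPath⇒InEFrom e)

≡⇒≈UF : ∀ {p q} → p ≡ q → p ≈UF q
≡⇒≈UF {p} refl k i = ⇔-id (Occ p k i)

Occ-zero⇔ : ∀ p q k → Occ p k 0 ⇔ Occ q k 0
Occ-zero⇔ p q k = mk⇔ (λ (e , _) → ⊥-elim (stepAt-zero p e)) (λ (e , _) → ⊥-elim (stepAt-zero q e))

≈UF-∷ : ∀ {s t} p q → (∀ k → Occ (s ∷ p) k 1 ⇔ Occ (t ∷ q) k 1) → p ≈UF q → (s ∷ p) ≈UF (t ∷ q)
≈UF-∷ {s} {t} p q first rest k zero = Occ-zero⇔ (s ∷ p) (t ∷ q) k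
≈UF-∷ p q first rest k (suc zero)    = first k
≈UF-∷ p q first rest k (suc (suc i)) = rest k (suc i)

≈UF-∷-noOcc : ∀ {s t} p q → (∀ k → ¬ Occ (s ∷ p) k 1) → (∀ k → ¬ Occ (t ∷ q) k 1) →
              p ≈UF q → (s ∷ p) ≈UF (t ∷ q)
≈UF-∷-noOcc p q noOcc noOcc′ = ≈UF-∷ p q λ k → mk⇔ (⊥-elim ∘ noOcc k) (⊥-elim ∘ noOcc′ k)

≈UF-tail : ∀ {s t p q} → (s ∷ p) ≈UF (t ∷ q) → p ≈UF q
≈UF-tail {p = p} {q} eq k zero = Occ-zero⇔ p q k
≈UF-tail eq k (suc i) = eq k (suc (suc i))

EPath-≈UF-unique : ∀ {h a b} → EPath h a → EPath h b → length a ≡ length b → a ≈UF b → a ≡ b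
EPath-≈UF-unique done       done        _   _  = refl
EPath-≈UF-unique (down a)   (down b)    len eq =
  cong (D ∷_) (EPath-≈UF-unique a b (suc-injective len) (≈UF-tail eq))
EPath-≈UF-unique (flat₀ a)  (flat₀ b)   len eq =
  cong (F ∷_) (EPath-≈UF-unique a b (suc-injective len) (≈UF-tail eq))
EPath-≈UF-unique (upFlat {k = k} a) (upFlat b) len eq with Equivalence.to (eq k 1) (refl , refl)
... | refl , _ =
  cong (λ p → U k ∷ F ∷ p)
       (EPath-≈UF-unique a b (suc-injective (suc-injective len)) (≈UF-tail (≈UF-tail eq)))
EPath-≈UF-unique (down _)  (upFlat {k = k} _) _ eq with Equivalence.from (eq k 1) (refl , refl)
... | () , _
EPath-≈UF-unique (flat₀ _) (upFlat {k = k} _) _ eq with Equivalence.from (eq k 1) (refl , refl)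
... | () , _
EPath-≈UF-unique (upFlat {k = k} _) (down _)  _ eq with Equivalence.to (eq k 1) (refl , refl)
... | () , _
EPath-≈UF-unique (upFlat {k = k} _) (flat₀ _) _ eq with Equivalence.to (eq k 1) (refl , refl)
... | () , _

towardAxis : ℕ → Step
towardAxis zero    = F
towardAxis (suc _) = D

normalise : ℕ → List Step → List Step
normalise h []            = []
normalise h (U k ∷ F ∷ p) = U k ∷ F ∷ normalise (h + suc k) p
normalise h (_ ∷ p)       = towardAxis h ∷ normalise (pred h) p

towardAxis-EPath : ∀ {h p} → EPath (pred h) p → EPath h (towardAxis h ∷ p)
towardAxis-EPath {zero}  e = flat₀ e
towardAxis-EPath {suc _} e = down e

towardAxis-∷-≈UF : ∀ h {s q} p → (∀ k → ¬ Occ (s ∷ p) k 1) → q ≈UF p → (towardAxis h ∷ q) ≈UF (s ∷ p)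
towardAxis-∷-≈UF zero    {q = q} p = ≈UF-∷-noOcc q p (λ _ ())
towardAxis-∷-≈UF (suc _) {q = q} p = ≈UF-∷-noOcc q p (λ _ ())

pred-≤-+ : ∀ {h h′} n → h ≤ h′ → pred h ≤ h′ + n
pred-≤-+ {h′ = h′} n h≤h′ = ≤-trans pred[n]≤n (≤-trans h≤h′ (m≤m+n h′ n))

normalise-EPath : ∀ {h h′ p} → LukPath h′ p → h ≤ h′ → EPath h (normalise h p)
normalise-EPath done     z≤n  = done
normalise-EPath (down l) h≤h′ = towardAxis-EPath (normalise-EPath l (pred-mono-≤ h≤h′))
normalise-EPath (flat l) h≤h′ = towardAxis-EPath (normalise-EPath l (≤-trans pred[n]≤n h≤h′))
normalise-EPath (up {k = k} {p = F ∷ _} (flat l)) h≤h′ =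
  upFlat (normalise-EPath l (+-monoˡ-≤ (suc k) h≤h′))
normalise-EPath (up {k = k} {p = []}      l) h≤h′ =
  towardAxis-EPath (normalise-EPath l (pred-≤-+ (suc k) h≤h′))
normalise-EPath (up {k = k} {p = D ∷ _}   l) h≤h′ =
  towardAxis-EPath (normalise-EPath l (pred-≤-+ (suc k) h≤h′))
normalise-EPath (up {k = k} {p = U _ ∷ _} l) h≤h′ =
  towardAxis-EPath (normalise-EPath l (pred-≤-+ (suc k) h≤h′))

length-normalise : ∀ h p → length (normalise h p) ≡ length p
length-normalise h []              = refl
length-normalise h (U k ∷ F ∷ p)   = cong (suc ∘ suc) (length-normalise (h + suc k) p)
length-normalise h (D ∷ p)         = cong suc (length-normalise (pred h) p)
length-normalise h (F ∷ p)         = cong suc (length-normalise (pred h) p)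
length-normalise h (U k ∷ [])      = refl
length-normalise h (U k ∷ D ∷ p)   = cong suc (length-normalise (pred h) (D ∷ p))
length-normalise h (U k ∷ U j ∷ p) = cong suc (length-normalise (pred h) (U j ∷ p))

normalise-≈UF : ∀ h p → normalise h p ≈UF p
normalise-≈UF h []              = ≡⇒≈UF {[]} refl
normalise-≈UF h (U k ∷ F ∷ p)   =
  ≈UF-∷ _ (F ∷ p) (λ k′ → ⇔-id _) (≈UF-∷-noOcc _ p (λ _ ()) (λ _ ()) (normalise-≈UF (h + suc k) p))
normalise-≈UF h (D ∷ p)         = towardAxis-∷-≈UF h p (λ _ ()) (normalise-≈UF (pred h) p)
normalise-≈UF h (F ∷ p)         = towardAxis-∷-≈UF h p (λ _ ()) (normalise-≈UF (pred h) p)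
normalise-≈UF h (U k ∷ [])      = towardAxis-∷-≈UF h [] (λ _ ()) (normalise-≈UF (pred h) [])
normalise-≈UF h (U k ∷ D ∷ p)   = towardAxis-∷-≈UF h (D ∷ p) (λ _ ()) (normalise-≈UF (pred h) (D ∷ p))
normalise-≈UF h (U k ∷ U j ∷ p) = towardAxis-∷-≈UF h (U j ∷ p) (λ _ ()) (normalise-≈UF (pred h) (U j ∷ p))

lemma4 : (n : ℕ) → Bijection (E-setoid n) (L/≈-setoid n)
lemma4 n = record
  { to        = λ (p , len , luk , _) → p , len , luk
  ; cong      = ≡⇒≈UF
  ; bijective = (λ {a} {b} → injective {a} {b}) , surjective
  }
  where
  injective : ∀ {a b : LukE n} → proj₁ a ≈UF proj₁ b → proj₁ a ≡ proj₁ b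
  injective {_ , len-a , luk-a , inE-a} {_ , len-b , luk-b , inE-b} =
    EPath-≈UF-unique (isLuk×InE⇒EPath luk-a inE-a) (isLuk×InE⇒EPath luk-b inE-b) (trans len-a (sym len-b))

  surjective : ∀ (y : Luk n) → ∃ λ (x : LukE n) → ∀ {z : LukE n} → proj₁ z ≡ proj₁ x → proj₁ z ≈UF proj₁ y
  surjective (p , len , luk) =
    (normalise 0 p , trans (length-normalise 0 p) len , EPath⇒isLuk e , EPath⇒InE e) ,
    λ z≡ → subst (_≈UF p) (sym z≡) (normalise-≈UF 0 p)
    where
    e : EPath 0 (normalise 0 p)
    e = normalise-EPath (isLukFrom⇒LukPath p (Equivalence.to (isLuk⇔isLukFrom₀ p) luk)) z≤n
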